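{- A disconnected graph $G$ is $6$-$\gamma_{tR}$-edge-supercritical if and only if $G\cong K_n\cup K_m$ for some $n,m\geq 3$.
   Context: All graphs are finite and simple. A total Roman dominating function (TRD-function) on a graph $G$ with no isolated vertices is a function $f:V(G)\to\{0,1,2\}$ such that every vertex $v$ with $f(v)=0$ is adjacent to some $u$ with $f(u)=2$, and the subgraph induced by $\{w:f(w)>0\}$ has no isolated vertices; its weight is $\sum_v f(v)$ and $\gamma_{tR}(G)$ is the minimum weight. A graph $G$ with no isolated vertices is $k$-$\gamma_{tR}$-edge-supercritical if $\gamma_{tR}(G)=k$, $E(\overline{G})\neq\emptyset$, and $\gamma_{tR}(G+e)\leq\gamma_{tR}(G)-2$ for every $e\in E(\overline{G})$. -}

module Defs where

open import Data.Nat using (ℕ; _+_; _≤_; _<ᵇ_)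
open import Data.Bool using (Bool; true; false; _∧_; _∨_; not) renaming (_≟_ to _≟ᵇ_)
open import Data.Fin using (Fin; toℕ)
open import Data.Fin.Properties using () renaming (_≟_ to _≟ᶠ_)
open import Data.List using (List; map; allFin)
open import Data.Nat.ListAction using (sum)
open import Data.Product using (Σ; ∃; _×_; _,_)
open import Relation.Binary.PropositionalEquality using (_≡_; _≢_)
open import Relation.Nullary using (¬_; ⌊_⌋)
open import Function.Bundles using (_↔_; Inverse)

Adj : ℕ → Set
Adj N = Fin N → Fin N → Bool

IsSimple : ∀ {N} → Adj N → Set
IsSimple {N} A = (∀ u v → A u v ≡ A v u) × (∀ u → A u u ≡ false)

NoIsolated : ∀ {N} → Adj N → Set
NoIsolated {N} A = ∀ (v : Fin N) → ∃ λ u → A v u ≡ true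

data RVal : Set where
  r0 r1 r2 : RVal

val : RVal → ℕ
val r0 = 0
val r1 = 1
val r2 = 2

weight : ∀ {N} → (Fin N → RVal) → ℕ
weight {N} f = sum (map (λ v → val (f v)) (allFin N))

IsTRDF : ∀ {N} → Adj N → (Fin N → RVal) → Set
IsTRDF {N} A f =
  (∀ v → f v ≡ r0 → ∃ λ u → A v u ≡ true × f u ≡ r2) ×
  (∀ v → f v ≢ r0 → ∃ λ u → A v u ≡ true × f u ≢ r0)

IsγtR : ∀ {N} → Adj N → ℕ → Set
IsγtR {N} A k =
  (∃ λ (f : Fin N → RVal) → IsTRDF A f × weight f ≡ k) ×
  (∀ (f : Fin N → RVal) → IsTRDF A f → k ≤ weight f)

_==ᶠ_ : ∀ {N} → Fin N → Fin N → Bool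
x ==ᶠ y = ⌊ x ≟ᶠ y ⌋

addEdge : ∀ {N} → Adj N → Fin N → Fin N → Adj N
addEdge A u v x y = A x y ∨ ((x ==ᶠ u ∧ y ==ᶠ v) ∨ (x ==ᶠ v ∧ y ==ᶠ u))

NonEdge : ∀ {N} → Adj N → Fin N → Fin N → Set
NonEdge A u v = u ≢ v × A u v ≡ false

EdgeSupercritical : ∀ {N} → ℕ → Adj N → Set
EdgeSupercritical {N} k A =
  NoIsolated A × IsγtR A k ×
  (∃ λ u → ∃ λ v → NonEdge A u v) ×
  (∀ u v → NonEdge A u v → ∀ j → IsγtR (addEdge A u v) j → j + 2 ≤ k)

data Reach {N} (A : Adj N) : Fin N → Fin N → Set where
  here : ∀ {u} → Reach A u u
  step : ∀ {u w v} → A u w ≡ true → Reach A w v → Reach A u v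

Connected : ∀ {N} → Adj N → Set
Connected A = ∀ u v → Reach A u v

Disconnected : ∀ {N} → Adj N → Set
Disconnected A = ¬ Connected A

-- K_n ∪ K_m on Fin (n + m): first n vertices and last m vertices form cliques
KnUKm : (n m : ℕ) → Adj (n + m)
KnUKm n m x y = not (x ==ᶠ y) ∧ ⌊ (toℕ x <ᵇ n) ≟ᵇ (toℕ y <ᵇ n) ⌋

_≅_ : ∀ {N K} → Adj N → Adj K → Set
_≅_ {N} {K} A B = Σ (Fin N ↔ Fin K) λ φ →
  ∀ u v → A u v ≡ B (Inverse.to φ u) (Inverse.to φ v)

-- On a union R of components of a graph, a TRD-function has weight at least 2, and at least 3
-- when R has three vertices: a vertex of value 0 or 2 is or sees a vertex of value 2, which has a
-- positive neighbour, and otherwise three vertices of value 1 are present. Hence K_n ∪ K_m with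
-- n, m ≥ 3 has γ_tR = 6, while after adding an edge uv the function u, v ↦ 2 has weight 4.
-- Conversely, let G be disconnected and 6-supercritical, and uw a non-edge. Then γ_tR(G + uw) ≤ 4,
-- so no vertex z lies outside the components of u and w: in G + uw these form a region with three
-- vertices and the rest a nonempty region, forcing weight 3 + 2. Hence every component is a clique
-- and there are exactly two of them. If one clique had only two vertices c, c′, then d ↦ 2 for a
-- vertex d of the other clique and c, c′, d′ ↦ 1 for a neighbour d′ of d would have weight 5.
module Submission where

open import Defs
open import Data.Bool using (Bool; true; false; not; _∧_; _∨_) renaming (_≟_ to _≟ᵇ_)
open import Data.Bool.Properties using (not-involutive; ¬-not; not-¬; ∨-zeroʳ; ⇔→≡)
open import Data.Empty using (⊥; ⊥-elim)
open import Data.Fin using (Fin; zero; suc; toℕ; join; _↑ˡ_; _↑ʳ_)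
open import Data.Fin.Properties using (any?; ↑ˡ-injective; ↑ʳ-injective; +↔⊎) renaming (_≟_ to _≟ᶠ_)
open import Data.List using (List; []; _∷_; map; _++_; length; allFin)
open import Data.List.Properties using (map-++; length-tabulate)
open import Data.List.Membership.Propositional using (_∈_; _∉_)
open import Data.List.Membership.Propositional.Properties using (∈-∃++; ∈-allFin; ∈-++⁻; ∈-++⁺ˡ; ∈-++⁺ʳ)
import Data.List.Membership.DecPropositional as DecMembership
open import Data.List.Relation.Unary.All using (All; []; _∷_; lookup)
open import Data.List.Relation.Unary.Any using (here; there)
open import Data.List.Relation.Unary.Unique.Propositional using (Unique; []; _∷_)
open import Data.List.Relation.Unary.Unique.Propositional.Properties using (allFin⁺) renaming (++⁺ to Unique-++⁺)
open import Data.List.Relation.Binary.Disjoint.Propositional using (Disjoint)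
open import Data.List.Relation.Binary.Subset.Propositional using (_⊆_)
open import Data.List.Relation.Binary.Permutation.Propositional using (_↭_)
open import Data.List.Relation.Binary.Permutation.Propositional.Properties using (shift; ∈-resp-↭; map⁺)
open import Data.Nat using (ℕ; zero; suc; _+_; _*_; _≤_; _<_; _<ᵇ_; z≤n; s≤s; _≟_)
open import Data.Nat.Properties using (≤-refl; ≤-trans; ≤-reflexive; ≤-antisym; ≤-pred; ≮⇒≥; n≤1+n; 1+n≰n;
  +-mono-≤; +-monoˡ-≤; +-monoʳ-≤; +-identityʳ; *-identityʳ; module ≤-Reasoning)
open import Data.Nat.ListAction using (sum)
open import Data.Nat.ListAction.Properties using (sum-↭; sum-++)
open import Data.Product using (∃; _×_; _,_; proj₁; proj₂)
open import Data.Sum using (_⊎_; inj₁; inj₂; [_,_]; swap; map₁) renaming (map to map-⊎)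
open import Data.Sum.Algebra using (⊎-comm)
open import Data.Unit using (⊤; tt)
open import Function using (_∘_; const; Injective)
open import Function.Bundles using (_↔_; _⇔_; Inverse; Injection; mk↔ₛ′; mk⇔)
open import Function.Properties.Inverse using (↔⇒↣)
open import Function.Construct.Composition using (_↔-∘_)
open import Function.Construct.Symmetry using (↔-sym)
open import Relation.Binary.PropositionalEquality using (_≡_; _≢_; refl; sym; trans; cong; cong₂; subst)
open import Relation.Nullary using (¬_; Dec; yes; no; contradiction; ⌊_⌋; ¬?; _×-dec_)

module _ {P : Set} where

  ⌊⌋-true⁺ : (d : Dec P) → P → ⌊ d ⌋ ≡ true
  ⌊⌋-true⁺ (yes _) _ = refl
  ⌊⌋-true⁺ (no ¬p) p = contradiction p ¬p

  ⌊⌋-true⁻ : (d : Dec P) → ⌊ d ⌋ ≡ true → P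
  ⌊⌋-true⁻ (yes p) _ = p

  ⌊⌋-false⁺ : (d : Dec P) → ¬ P → ⌊ d ⌋ ≡ false
  ⌊⌋-false⁺ (yes p) ¬p = contradiction p ¬p
  ⌊⌋-false⁺ (no _) _   = refl

==ᶠ-refl : ∀ {N} (x : Fin N) → (x ==ᶠ x) ≡ true
==ᶠ-refl x = ⌊⌋-true⁺ (x ≟ᶠ x) refl

==ᶠ-≢ : ∀ {N} {x y : Fin N} → x ≢ y → (x ==ᶠ y) ≡ false
==ᶠ-≢ {x = x} {y} = ⌊⌋-false⁺ (x ≟ᶠ y)

==ᶠ-injective : ∀ {N K} {h : Fin N → Fin K} → Injective _≡_ _≡_ h → ∀ u v → (h u ==ᶠ h v) ≡ (u ==ᶠ v)
==ᶠ-injective {h = h} h-injective u v with u ≟ᶠ v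
... | yes refl = ==ᶠ-refl (h u)
... | no u≢v   = ==ᶠ-≢ (u≢v ∘ h-injective)

module _ {A : Set} where

  ∈⇒↭∷ : ∀ {x : A} {ys} → x ∈ ys → ∃ λ zs → ys ↭ x ∷ zs
  ∈⇒↭∷ {x} x∈ys with as , bs , refl ← ∈-∃++ x∈ys = as ++ bs , shift x as bs

  ∈-↭∷⁻ : ∀ {x y : A} {ys zs} → ys ↭ x ∷ zs → y ∈ ys → y ≢ x → y ∈ zs
  ∈-↭∷⁻ p y∈ys y≢x with ∈-resp-↭ p y∈ys
  ... | here y≡x = contradiction y≡x y≢x
  ... | there y∈zs = y∈zs

  sum-map-↭∷ : (g : A → ℕ) → ∀ {x ys zs} → ys ↭ x ∷ zs → sum (map g ys) ≡ g x + sum (map g zs)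
  sum-map-↭∷ g p = sum-↭ (map⁺ g p)

  sum-map-mono-⊆ : (g : A → ℕ) {xs ys : List A} → Unique xs → xs ⊆ ys →
    sum (map g xs) ≤ sum (map g ys)
  sum-map-mono-⊆ g {[]} _ _ = z≤n
  sum-map-mono-⊆ g {x ∷ xs} {ys} (x∉xs ∷ xs-unique) xs⊆ys with zs , ys↭ ← ∈⇒↭∷ (xs⊆ys (here refl)) = begin
    g x + sum (map g xs) ≤⟨ +-monoʳ-≤ (g x) (sum-map-mono-⊆ g xs-unique xs⊆zs) ⟩
    g x + sum (map g zs) ≡⟨ sum-map-↭∷ g ys↭ ⟨
    sum (map g ys)       ∎
    where
    open ≤-Reasoning
    xs⊆zs : xs ⊆ zs
    xs⊆zs y∈xs = ∈-↭∷⁻ ys↭ (xs⊆ys (there y∈xs)) (λ y≡x → lookup x∉xs y∈xs (sym y≡x))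

  sum-map-≤-support : (g : A → ℕ) {xs ys : List A} → Unique ys →
    (∀ {y} → y ∈ ys → g y ≢ 0 → y ∈ xs) → sum (map g ys) ≤ sum (map g xs)
  sum-map-≤-support g {ys = []} _ _ = z≤n
  sum-map-≤-support g {xs} {y ∷ ys} (y∉ys ∷ ys-unique) supp with g y ≟ 0
  ... | yes gy≡0 rewrite gy≡0 = sum-map-≤-support g ys-unique (supp ∘ there)
  ... | no gy≢0 with zs , xs↭ ← ∈⇒↭∷ (supp (here refl) gy≢0) = begin
    g y + sum (map g ys) ≤⟨ +-monoʳ-≤ (g y) (sum-map-≤-support g ys-unique supp′) ⟩
    g y + sum (map g zs) ≡⟨ sum-map-↭∷ g xs↭ ⟨
    sum (map g xs)       ∎
    where
    open ≤-Reasoning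
    supp′ : ∀ {y′} → y′ ∈ ys → g y′ ≢ 0 → y′ ∈ zs
    supp′ y′∈ys gy′≢0 = ∈-↭∷⁻ xs↭ (supp (there y′∈ys) gy′≢0) (λ y′≡y → lookup y∉ys y′∈ys (sym y′≡y))

  sum-map-const : (g : A → ℕ) {c : ℕ} {xs : List A} → (∀ {x} → x ∈ xs → g x ≡ c) →
    sum (map g xs) ≡ length xs * c
  sum-map-const g {xs = []} _ = refl
  sum-map-const g {xs = x ∷ xs} g≡c = cong₂ _+_ (g≡c (here refl)) (sum-map-const g (g≡c ∘ there))

record Triple {A : Set} (S : A → Set) : Set where
  constructor triple
  field
    a b c : A
    a∈ : S a
    b∈ : S b
    c∈ : S c
    a≢b : a ≢ b
    a≢c : a ≢ c
    b≢c : b ≢ c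

Triple⇒3≤ : ∀ {k} {S : Fin k → Set} → Triple S → 3 ≤ k
Triple⇒3≤ {k} (triple a b c _ _ _ a≢b a≢c b≢c) = begin
  sum (map (const 1) (a ∷ b ∷ c ∷ []))
    ≤⟨ sum-map-mono-⊆ (const 1) ((a≢b ∷ a≢c ∷ []) ∷ (b≢c ∷ []) ∷ [] ∷ []) (λ {x} _ → ∈-allFin x) ⟩
  sum (map (const 1) (allFin k)) ≡⟨ sum-map-const (const 1) {xs = allFin k} (λ _ → refl) ⟩
  length (allFin k) * 1          ≡⟨ *-identityʳ _ ⟩
  length (allFin k)              ≡⟨ length-tabulate (λ i → i) ⟩
  k                              ∎
  where open ≤-Reasoning

Triple-Fin : ∀ {k} {A : Set} {S : A → Set} → 3 ≤ k → (g : Fin k → A) → Injective _≡_ _≡_ g →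
  (∀ i → S (g i)) → Triple S
Triple-Fin (s≤s (s≤s (s≤s _))) g g-injective g∈ =
  triple (g zero) (g (suc zero)) (g (suc (suc zero))) (g∈ _) (g∈ _) (g∈ _)
    ((λ ()) ∘ g-injective) ((λ ()) ∘ g-injective) ((λ ()) ∘ g-injective)

Triple-map : ∀ {A : Set} {S S′ : A → Set} → (∀ {x} → S x → S′ x) → Triple S → Triple S′
Triple-map S⊆S′ (triple a b c a∈ b∈ c∈ a≢b a≢c b≢c) = triple a b c (S⊆S′ a∈) (S⊆S′ b∈) (S⊆S′ c∈) a≢b a≢c b≢c

module _ {N} {S : Fin N → Set} (T : Triple S) where
  open Triple T

  private
    besides-a : ∀ x → ∃ λ t → S t × t ≢ a × t ≢ x
    besides-a x with b ≟ᶠ x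
    ... | no b≢x   = b , b∈ , a≢b ∘ sym , b≢x
    ... | yes refl = c , c∈ , a≢c ∘ sym , b≢c ∘ sym

  Triple-avoid : ∀ v w → ∃ λ t → S t × t ≢ v × t ≢ w
  Triple-avoid v w with a ≟ᶠ v | a ≟ᶠ w
  ... | no a≢v   | no a≢w   = a , a∈ , a≢v , a≢w
  ... | yes refl | _        = besides-a w
  ... | no _     | yes refl with t , t∈ , t≢a , t≢v ← besides-a v = t , t∈ , t≢v , t≢a

val-pos : ∀ {r} → r ≢ r0 → 1 ≤ val r
val-pos {r0} r≢r0 = contradiction refl r≢r0
val-pos {r1} _    = s≤s z≤n
val-pos {r2} _    = s≤s z≤n

module _ {N : ℕ} where

  sum-≤-weight : (f : Fin N → RVal) {xs : List (Fin N)} → Unique xs → sum (map (val ∘ f) xs) ≤ weight f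
  sum-≤-weight f xs-unique = sum-map-mono-⊆ (val ∘ f) xs-unique (λ {v} _ → ∈-allFin v)

  weight-≤-support : (f : Fin N → RVal) {xs : List (Fin N)} → (∀ {v} → f v ≢ r0 → v ∈ xs) →
    weight f ≤ sum (map (val ∘ f) xs)
  weight-≤-support f supp = sum-map-≤-support (val ∘ f) (allFin⁺ N) (λ _ fv≢0 → supp (fv≢0 ∘ cong val))

  open DecMembership (_≟ᶠ_ {N}) using (_∈?_)

  -- In the paper's notation f = (V₀, V₁, V₂), this is the function with V₂ = twos, V₁ = ones ∖ twos.
  roman : List (Fin N) → List (Fin N) → Fin N → RVal
  roman twos ones v with v ∈? twos | v ∈? ones
  ... | yes _ | _     = r2
  ... | no _  | yes _ = r1
  ... | no _  | no _  = r0

  module _ {twos ones : List (Fin N)} where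

    roman-r2 : ∀ {v} → v ∈ twos → roman twos ones v ≡ r2
    roman-r2 {v} v∈twos with v ∈? twos
    ... | yes _     = refl
    ... | no v∉twos = contradiction v∈twos v∉twos

    roman-r1 : ∀ {v} → v ∉ twos → v ∈ ones → roman twos ones v ≡ r1
    roman-r1 {v} v∉twos v∈ones with v ∈? twos | v ∈? ones
    ... | yes v∈twos | _         = contradiction v∈twos v∉twos
    ... | no _       | yes _     = refl
    ... | no _       | no v∉ones = contradiction v∈ones v∉ones

    roman-r0 : ∀ {v} → roman twos ones v ≡ r0 → v ∉ twos × v ∉ ones
    roman-r0 {v} fv≡r0 with v ∈? twos | v ∈? ones
    roman-r0 () | yes _ | _
    roman-r0 () | no _  | yes _
    ... | no v∉twos | no v∉ones = v∉twos , v∉ones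

    roman-support : ∀ {v} → roman twos ones v ≢ r0 → v ∈ twos ++ ones
    roman-support {v} fv≢r0 with v ∈? twos | v ∈? ones
    ... | yes v∈twos | _         = ∈-++⁺ˡ v∈twos
    ... | no _       | yes v∈ones = ∈-++⁺ʳ twos v∈ones
    ... | no _       | no _      = contradiction refl fv≢r0

    roman-≢r0 : ∀ {v} → v ∈ twos ++ ones → roman twos ones v ≢ r0
    roman-≢r0 v∈ fv≡r0 with v∉twos , v∉ones ← roman-r0 fv≡r0 = [ v∉twos , v∉ones ] (∈-++⁻ twos v∈)

    weight-roman : Disjoint twos ones → weight (roman twos ones) ≤ length twos * 2 + length ones
    weight-roman twos∩ones=∅ = begin
      weight f                                        ≤⟨ weight-≤-support f roman-support ⟩
      sum (map g (twos ++ ones))                      ≡⟨ cong sum (map-++ g twos ones) ⟩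
      sum (map g twos ++ map g ones)                  ≡⟨ sum-++ (map g twos) (map g ones) ⟩
      sum (map g twos) + sum (map g ones)             ≡⟨ cong₂ _+_ (sum-map-const g (cong val ∘ roman-r2))
                                                                   (sum-map-const g (cong val ∘ one)) ⟩
      length twos * 2 + length ones * 1               ≡⟨ cong (length twos * 2 +_) (*-identityʳ _) ⟩
      length twos * 2 + length ones                   ∎
      where
      open ≤-Reasoning
      f : Fin N → RVal
      f = roman twos ones
      g : Fin N → ℕ
      g = val ∘ f
      one : ∀ {v} → v ∈ ones → f v ≡ r1
      one v∈ones = roman-r1 (λ v∈twos → twos∩ones=∅ (v∈twos , v∈ones)) v∈ones

    roman-isTRDF : {H : Adj N} →
      (∀ v → v ∉ twos → v ∉ ones → ∃ λ u → u ∈ twos × H v u ≡ true) →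
      (∀ {v} → v ∈ twos ++ ones → ∃ λ u → u ∈ twos ++ ones × H v u ≡ true) →
      IsTRDF H (roman twos ones)
    roman-isTRDF {H} dominated paired = zero-case , positive-case
      where
      zero-case : ∀ v → roman twos ones v ≡ r0 → ∃ λ u → H v u ≡ true × roman twos ones u ≡ r2
      zero-case v fv≡r0 =
        let v∉twos , v∉ones = roman-r0 fv≡r0
            u , u∈twos , Hvu = dominated v v∉twos v∉ones
        in u , Hvu , roman-r2 u∈twos
      positive-case : ∀ v → roman twos ones v ≢ r0 → ∃ λ u → H v u ≡ true × roman twos ones u ≢ r0
      positive-case v fv≢r0 with u , u∈ , Hvu ← paired (roman-support fv≢r0) = u , Hvu , roman-≢r0 u∈

Loopless : ∀ {N} → Adj N → Set
Loopless {N} A = ∀ (x : Fin N) → A x x ≡ false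

Closed : ∀ {N} → Adj N → (Fin N → Set) → Set
Closed {N} A R = ∀ {x y : Fin N} → R x → A x y ≡ true → R y

module _ {N} {A : Adj N} where

  adj⇒≢ : Loopless A → ∀ {x y} → A x y ≡ true → x ≢ y
  adj⇒≢ loopless {x} Axy refl = contradiction (trans (sym Axy) (loopless x)) λ ()

  Reach-trans : ∀ {x y z} → Reach A x y → Reach A y z → Reach A x z
  Reach-trans here           y⇝z = y⇝z
  Reach-trans (step Axw w⇝y) y⇝z = step Axw (Reach-trans w⇝y y⇝z)

  Reach-snoc : ∀ {x y z} → Reach A x y → A y z ≡ true → Reach A x z
  Reach-snoc x⇝y Ayz = Reach-trans x⇝y (step Ayz here)

  Reach-sym : (∀ x y → A x y ≡ A y x) → ∀ {x y} → Reach A x y → Reach A y x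
  Reach-sym symmetric here = here
  Reach-sym symmetric {x} (step {w = w} Axw w⇝y) =
    Reach-snoc (Reach-sym symmetric w⇝y) (trans (symmetric w x) Axw)

module _ {N} (A : Adj N) (u v : Fin N) where

  addEdge-⊇ : ∀ {x y} → A x y ≡ true → addEdge A u v x y ≡ true
  addEdge-⊇ Axy = cong (_∨ _) Axy

  addEdge-uv : addEdge A u v u v ≡ true
  addEdge-uv rewrite ==ᶠ-refl u | ==ᶠ-refl v = ∨-zeroʳ (A u v)

  addEdge-vu : addEdge A u v v u ≡ true
  addEdge-vu rewrite ==ᶠ-refl u | ==ᶠ-refl v | ∨-zeroʳ (v ==ᶠ u ∧ u ==ᶠ v) = ∨-zeroʳ (A v u)

  addEdge⁻ : ∀ {x y} → addEdge A u v x y ≡ true → A x y ≡ true ⊎ (x ≡ u × y ≡ v) ⊎ (x ≡ v × y ≡ u)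
  addEdge⁻ {x} {y} e with A x y | x ≟ᶠ u | y ≟ᶠ v | x ≟ᶠ v | y ≟ᶠ u
  ... | true  | _      | _      | _      | _      = inj₁ refl
  ... | false | yes xu | yes yv | _      | _      = inj₂ (inj₁ (xu , yv))
  ... | false | _      | _      | yes xv | yes yu = inj₂ (inj₂ (xv , yu))
  ... | false | no _   | _      | no _   | _      = contradiction e λ ()
  ... | false | no _   | _      | yes _  | no _   = contradiction e λ ()
  ... | false | yes _  | no _   | no _   | _      = contradiction e λ ()
  ... | false | yes _  | no _   | yes _  | no _   = contradiction e λ ()

  addEdge-loopless : u ≢ v → Loopless A → Loopless (addEdge A u v)
  addEdge-loopless u≢v loopless x rewrite loopless x with x ≟ᶠ u | x ≟ᶠ v
  ... | yes x≡u | yes x≡v = contradiction (trans (sym x≡u) x≡v) u≢v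
  ... | yes _   | no _    = refl
  ... | no _    | yes _   = refl
  ... | no _    | no _    = refl

-- Weight carried by a closed region

record WeightOn≥ {N} (f : Fin N → RVal) (R : Fin N → Set) (k : ℕ) : Set where
  constructor weightOn
  field
    vertices : List (Fin N)
    unique   : Unique vertices
    inside   : All R vertices
    bound    : k ≤ sum (map (val ∘ f) vertices)

module _ {N} {f : Fin N → RVal} where

  weightOn-weaken : ∀ {R k l} → l ≤ k → WeightOn≥ f R k → WeightOn≥ f R l
  weightOn-weaken l≤k (weightOn xs xs-unique xs⊆R k≤) = weightOn xs xs-unique xs⊆R (≤-trans l≤k k≤)

  weightOn-disjoint : ∀ {R S k l} → WeightOn≥ f R k → WeightOn≥ f S l → (∀ {x} → R x → ¬ S x) →
    k + l ≤ weight f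
  weightOn-disjoint {k = k} {l} (weightOn xs xs-unique xs⊆R k≤) (weightOn ys ys-unique ys⊆S l≤) R∩S=∅ = begin
    k + l                           ≤⟨ +-mono-≤ k≤ l≤ ⟩
    sum (map g xs) + sum (map g ys) ≡⟨ sum-++ (map g xs) (map g ys) ⟨
    sum (map g xs ++ map g ys)      ≡⟨ cong sum (map-++ g xs ys) ⟨
    sum (map g (xs ++ ys))          ≤⟨ sum-≤-weight f (Unique-++⁺ xs-unique ys-unique xs∩ys=∅) ⟩
    weight f                        ∎
    where
    open ≤-Reasoning
    g : Fin N → ℕ
    g = val ∘ f
    xs∩ys=∅ : Disjoint xs ys
    xs∩ys=∅ (v∈xs , v∈ys) = R∩S=∅ (lookup xs⊆R v∈xs) (lookup ys⊆S v∈ys)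

module _ {N} {H : Adj N} (loopless : Loopless H) {f : Fin N → RVal} (trdf : IsTRDF H f)
         {R : Fin N → Set} (closed : Closed H R) where

  private
    dominator : ∀ {x} → f x ≡ r0 → ∃ λ y → H x y ≡ true × f y ≡ r2
    dominator = proj₁ trdf _

    partner : ∀ {x} → f x ≢ r0 → ∃ λ y → H x y ≡ true × f y ≢ r0
    partner = proj₂ trdf _

  edgeWeightOn : ∀ {x y} → R x → H x y ≡ true → WeightOn≥ f R (val (f x) + val (f y))
  edgeWeightOn {x} {y} x∈R Hxy =
    weightOn (x ∷ y ∷ []) ((adj⇒≢ loopless Hxy ∷ []) ∷ [] ∷ []) (x∈R ∷ closed x∈R Hxy ∷ [])
      (≤-reflexive (cong (val (f x) +_) (sym (+-identityʳ (val (f y))))))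

  weightOn≥3-from-r2 : ∀ {x} → R x → f x ≡ r2 → WeightOn≥ f R 3
  weightOn≥3-from-r2 {x} x∈R fx≡r2 with y , Hxy , fy≢r0 ← partner (subst (_≢ r0) (sym fx≡r2) λ ()) =
    weightOn-weaken (subst (λ r → 3 ≤ val r + val (f y)) (sym fx≡r2) (s≤s (s≤s (val-pos fy≢r0))))
      (edgeWeightOn x∈R Hxy)

  weightOn≥3-from-r0 : ∀ {x} → R x → f x ≡ r0 → WeightOn≥ f R 3
  weightOn≥3-from-r0 x∈R fx≡r0 with y , Hxy , fy≡r2 ← dominator fx≡r0 =
    weightOn≥3-from-r2 (closed x∈R Hxy) fy≡r2

  weightOn≥2 : ∀ {x} → R x → WeightOn≥ f R 2
  weightOn≥2 {x} x∈R with f x in fx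
  ... | r0 = weightOn-weaken (n≤1+n 2) (weightOn≥3-from-r0 x∈R fx)
  ... | r2 = weightOn-weaken (n≤1+n 2) (weightOn≥3-from-r2 x∈R fx)
  ... | r1 with y , Hxy , fy≢r0 ← partner (subst (_≢ r0) (sym fx) λ ()) =
    weightOn-weaken (subst (λ r → 2 ≤ val r + val (f y)) (sym fx) (s≤s (val-pos fy≢r0)))
      (edgeWeightOn x∈R Hxy)

  weightOn≥3 : Triple R → WeightOn≥ f R 3
  weightOn≥3 T@(triple a _ _ a∈R _ _ _ _ _) with f a in fa
  ... | r0 = weightOn≥3-from-r0 a∈R fa
  ... | r2 = weightOn≥3-from-r2 a∈R fa
  ... | r1 with partner (subst (_≢ r0) (sym fa) λ ())
  ... | q , Haq , _ with f q in fq
  ... | r0 = weightOn≥3-from-r0 (closed a∈R Haq) fq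
  ... | r2 = weightOn≥3-from-r2 (closed a∈R Haq) fq
  ... | r1 with Triple-avoid T a q
  ... | t , t∈R , t≢a , t≢q with f t in ft
  ... | r0 = weightOn≥3-from-r0 t∈R ft
  ... | r2 = weightOn≥3-from-r2 t∈R ft
  ... | r1 = weightOn (a ∷ q ∷ t ∷ [])
                      ((adj⇒≢ loopless Haq ∷ t≢a ∘ sym ∷ []) ∷ (t≢q ∘ sym ∷ []) ∷ [] ∷ [])
                      (a∈R ∷ closed a∈R Haq ∷ t∈R ∷ [])
                      (≤-reflexive (sym weight≡3))
    where
    weight≡3 : val (f a) + (val (f q) + (val (f t) + 0)) ≡ 3
    weight≡3 rewrite fa | fq | ft = refl

-- Supercriticality

¬¬-minimum : {A : Set} (w : A → ℕ) {P : A → Set} {a : A} → P a →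
  ¬ ¬ (∃ λ a → P a × ∀ b → P b → w a ≤ w b)
¬¬-minimum {A} w {P} {a} pa ¬minimum = descend (w a) pa ≤-refl
  where
  descend : ∀ n {a} → P a → w a ≤ n → ⊥
  below : ∀ n {b} → w b < n → P b → ⊥
  descend n {a} pa wa≤n = ¬minimum (a , pa , λ b pb → ≮⇒≥ λ wb<wa → below n (≤-trans wb<wa wa≤n) pb)
  below (suc n) wb<1+n pb = descend n pb (≤-pred wb<1+n)

¬¬γtR : ∀ {N} {H : Adj N} → NoIsolated H → ¬ ¬ ∃ (IsγtR H)
¬¬γtR {H = H} noIsolated ¬γ =
  ¬¬-minimum weight {IsTRDF H} all-r1 λ (f , trdf , minimal) → ¬γ (weight f , (f , trdf , refl) , minimal)
  where
  all-r1 : IsTRDF H (const r1)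
  all-r1 = (λ _ ()) , λ v _ → proj₁ (noIsolated v) , proj₂ (noIsolated v) , λ ()

supercritical⇒lightTRDF : ∀ {N k} {G : Adj N} {u v} → EdgeSupercritical k G → NonEdge G u v →
  ¬ ¬ ∃ λ h → IsTRDF (addEdge G u v) h × weight h + 2 ≤ k
supercritical⇒lightTRDF {G = G} {u} {v} (noIsolated , _ , _ , drop) uv ¬light =
  ¬¬γtR noIsolated′ λ (j , γ@((h , trdf , wh≡j) , _)) →
    ¬light (h , trdf , subst (λ w → w + 2 ≤ _) (sym wh≡j) (drop u v uv j γ))
  where
  noIsolated′ : NoIsolated (addEdge G u v)
  noIsolated′ x = proj₁ (noIsolated x) , addEdge-⊇ G u v (proj₂ (noIsolated x))

¬¬-∀-Fin : ∀ {n} {P : Fin n → Set} → (∀ i → ¬ ¬ P i) → ¬ ¬ (∀ i → P i)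
¬¬-∀-Fin {zero}  _   ¬∀ = ¬∀ λ ()
¬¬-∀-Fin {suc n} ¬¬P ¬∀ = ¬¬P zero λ p₀ → ¬¬-∀-Fin (¬¬P ∘ suc) λ p → ¬∀ λ { zero → p₀ ; (suc i) → p i }

¬¬-unreachable : ∀ {N} {G : Adj N} → (∀ x y → G x y ≡ G y x) → Disconnected G →
  ∀ u → ¬ ¬ ∃ λ z → ¬ Reach G u z
¬¬-unreachable symmetric disconnected u ¬∃ =
  ¬¬-∀-Fin (λ z ¬u⇝z → ¬∃ (z , ¬u⇝z)) λ u⇝ →
    disconnected λ x y → Reach-trans (Reach-sym symmetric (u⇝ x)) (u⇝ y)

module _ {N} {G : Adj N} (simple : IsSimple G) (noIsolated : NoIsolated G) {u w z : Fin N}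
         (uw : NonEdge G u w) (¬u⇝z : ¬ Reach G u z) (¬w⇝z : ¬ Reach G w z) where

  private
    H : Adj N
    H = addEdge G u w

    Near : Fin N → Set
    Near x = Reach G u x ⊎ Reach G w x

    near-snoc : ∀ {x y} → Near x → G x y ≡ true → Near y
    near-snoc near Gxy = map-⊎ (λ r → Reach-snoc r Gxy) (λ r → Reach-snoc r Gxy) near

    near-closed : Closed H Near
    near-closed near Hxy with addEdge⁻ G u w Hxy
    ... | inj₁ Gxy                = near-snoc near Gxy
    ... | inj₂ (inj₁ (_ , refl)) = inj₂ here
    ... | inj₂ (inj₂ (_ , refl)) = inj₁ here

    far-closed : Closed H (¬_ ∘ Near)
    far-closed {x} {y} ¬near Hxy with addEdge⁻ G u w Hxy
    ... | inj₁ Gxy                = λ near → ¬near (near-snoc near (trans (proj₁ simple y x) Gxy))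
    ... | inj₂ (inj₁ (refl , _)) = contradiction (inj₁ here) ¬near
    ... | inj₂ (inj₂ (refl , _)) = contradiction (inj₂ here) ¬near

    nearTriple : Triple Near
    nearTriple = triple u w t (inj₁ here) (inj₂ here) (inj₁ (step Gut here))
                        (proj₁ uw) (adj⇒≢ {A = G} (proj₂ simple) Gut) w≢t
      where
      t : Fin N
      t = proj₁ (noIsolated u)
      Gut : G u t ≡ true
      Gut = proj₂ (noIsolated u)
      w≢t : w ≢ t
      w≢t refl = contradiction (trans (sym Gut) (proj₂ uw)) λ ()

  bridged-weight≥5 : ∀ {h} → IsTRDF H h → 5 ≤ weight h
  bridged-weight≥5 trdf =
    weightOn-disjoint (weightOn≥3 H-loopless trdf near-closed nearTriple)
                      (weightOn≥2 H-loopless trdf far-closed [ ¬u⇝z , ¬w⇝z ])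
                      λ near ¬near → ¬near near
    where
    H-loopless : Loopless H
    H-loopless = addEdge-loopless G u w (proj₁ uw) (proj₂ simple)

-- Unions of two cliques

-- KnUKm n m is definitionally cliquePairAdj (λ i → toℕ i <ᵇ n).
cliquePairAdj : ∀ {N} → (Fin N → Bool) → Adj N
cliquePairAdj side x y = not (x ==ᶠ y) ∧ ⌊ side x ≟ᵇ side y ⌋

record IsCliquePair {N} (G : Adj N) (side : Fin N → Bool) : Set where
  field
    adj⇒sameSide : ∀ {u v} → G u v ≡ true → side u ≡ side v
    sameSide⇒adj : ∀ {u v} → u ≢ v → side u ≡ side v → G u v ≡ true

record LargeCliquePair {N} (G : Adj N) : Set where
  field
    side         : Fin N → Bool
    isCliquePair : IsCliquePair G side
    large        : ∀ s → Triple (λ x → side x ≡ s)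

module _ {N} {side : Fin N → Bool} where

  cliquePairAdj-≢ : ∀ {u v} → u ≢ v → cliquePairAdj side u v ≡ ⌊ side u ≟ᵇ side v ⌋
  cliquePairAdj-≢ u≢v rewrite ==ᶠ-≢ u≢v = refl

  cliquePairAdj-relabel : ∀ {K} {side′ : Fin K → Bool} (h : Fin N → Fin K) → Injective _≡_ _≡_ h →
    (∀ x → side x ≡ side′ (h x)) → ∀ u v → cliquePairAdj side u v ≡ cliquePairAdj side′ (h u) (h v)
  cliquePairAdj-relabel h h-injective side≡ u v =
    cong₂ (λ e s → not e ∧ s) (sym (==ᶠ-injective h-injective u v))
                              (cong₂ (λ s t → ⌊ s ≟ᵇ t ⌋) (side≡ u) (side≡ v))

  ≗cliquePairAdj⇒IsCliquePair : ∀ {G : Adj N} → (∀ u v → G u v ≡ cliquePairAdj side u v) → IsCliquePair G side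
  ≗cliquePairAdj⇒IsCliquePair {G} G≗ = record { adj⇒sameSide = adj⇒sameSide ; sameSide⇒adj = sameSide⇒adj }
    where
    adj⇒sameSide : ∀ {u v} → G u v ≡ true → side u ≡ side v
    adj⇒sameSide {u} {v} Guv with u ≟ᶠ v
    ... | yes refl = refl
    ... | no u≢v   =
      ⌊⌋-true⁻ (side u ≟ᵇ side v) (trans (sym (cliquePairAdj-≢ u≢v)) (trans (sym (G≗ u v)) Guv))
    sameSide⇒adj : ∀ {u v} → u ≢ v → side u ≡ side v → G u v ≡ true
    sameSide⇒adj {u} {v} u≢v su≡sv =
      trans (G≗ u v) (trans (cliquePairAdj-≢ u≢v) (⌊⌋-true⁺ (side u ≟ᵇ side v) su≡sv))

  IsCliquePair⇒≗cliquePairAdj : ∀ {G : Adj N} → Loopless G → IsCliquePair G side →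
    ∀ u v → G u v ≡ cliquePairAdj side u v
  IsCliquePair⇒≗cliquePairAdj {G} loopless cp u v with u ≟ᶠ v
  ... | yes refl = loopless u
  ... | no u≢v with side u ≟ᵇ side v
  ...   | yes su≡sv = IsCliquePair.sameSide⇒adj cp u≢v su≡sv
  ...   | no su≢sv with G u v in Guv
  ...     | true  = contradiction (IsCliquePair.adj⇒sameSide cp Guv) su≢sv
  ...     | false = refl

module _ {N} {G : Adj N} (simple : IsSimple G) (L : LargeCliquePair G) where
  open LargeCliquePair L
  open IsCliquePair isCliquePair
  open Triple (large true) using () renaming (a to a₀; b to a₁; a∈ to a₀∈; b∈ to a₁∈; a≢b to a₀≢a₁)
  open Triple (large false) using () renaming (a to b₀; b to b₁; a∈ to b₀∈; b∈ to b₁∈; a≢b to b₀≢b₁)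

  private
    loopless : Loopless G
    loopless = proj₂ simple

    adj-onSide : ∀ {x y s} → x ≢ y → side x ≡ s → side y ≡ s → G x y ≡ true
    adj-onSide x≢y sx sy = sameSide⇒adj x≢y (trans sx (sym sy))

    ≢-acrossSides : ∀ {x y} → side x ≡ true → side y ≡ false → x ≢ y
    ≢-acrossSides sx sy refl = contradiction (trans (sym sx) sy) λ ()

    side-closed : ∀ s → Closed G (λ x → side x ≡ s)
    side-closed s sx Gxy = trans (sym (adj⇒sameSide Gxy)) sx

    neighbour : NoIsolated G
    neighbour v with x , sx , x≢v , _ ← Triple-avoid (large (side v)) v v =
      x , sameSide⇒adj (x≢v ∘ sym) (sym sx)

    6≤weight : ∀ f → IsTRDF G f → 6 ≤ weight f
    6≤weight f trdf = weightOn-disjoint (weightOn≥3 loopless trdf (side-closed true) (large true))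
                                        (weightOn≥3 loopless trdf (side-closed false) (large false))
                                        λ sx≡true sx≡false → contradiction (trans (sym sx≡true) sx≡false) λ ()

    γtR≡6 : IsγtR G 6
    γtR≡6 = (f , trdf , ≤-antisym (weight-roman twos∩ones=∅) (6≤weight f trdf)) , 6≤weight
      where
      twos ones : List (Fin N)
      twos = a₀ ∷ b₀ ∷ []
      ones = a₁ ∷ b₁ ∷ []
      f : Fin N → RVal
      f = roman twos ones
      dominated : ∀ v → v ∉ twos → v ∉ ones → ∃ λ u → u ∈ twos × G v u ≡ true
      dominated v v∉twos _ with side v in sv
      ... | true  = a₀ , here refl , adj-onSide (v∉twos ∘ here) sv a₀∈
      ... | false = b₀ , there (here refl) , adj-onSide (v∉twos ∘ there ∘ here) sv b₀∈
      paired : ∀ {v} → v ∈ twos ++ ones → ∃ λ u → u ∈ twos ++ ones × G v u ≡ true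
      paired (here refl) = a₁ , there (there (here refl)) , adj-onSide a₀≢a₁ a₀∈ a₁∈
      paired (there (here refl)) = b₁ , there (there (there (here refl))) , adj-onSide b₀≢b₁ b₀∈ b₁∈
      paired (there (there (here refl))) = a₀ , here refl , adj-onSide (a₀≢a₁ ∘ sym) a₁∈ a₀∈
      paired (there (there (there (here refl)))) = b₀ , there (here refl) , adj-onSide (b₀≢b₁ ∘ sym) b₁∈ b₀∈
      twos∩ones=∅ : Disjoint twos ones
      twos∩ones=∅ (here refl         , here a₀≡a₁)         = a₀≢a₁ a₀≡a₁
      twos∩ones=∅ (here refl         , there (here a₀≡b₁)) = ≢-acrossSides a₀∈ b₁∈ a₀≡b₁
      twos∩ones=∅ (there (here refl) , here b₀≡a₁)         = ≢-acrossSides a₁∈ b₀∈ (sym b₀≡a₁)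
      twos∩ones=∅ (there (here refl) , there (here b₀≡b₁)) = b₀≢b₁ b₀≡b₁
      trdf : IsTRDF G f
      trdf = roman-isTRDF dominated paired

    γtR-drop : ∀ u v → NonEdge G u v → ∀ j → IsγtR (addEdge G u v) j → j + 2 ≤ 6
    γtR-drop u v (u≢v , Guv) j (_ , minimal) =
      +-monoˡ-≤ 2 (≤-trans (minimal f trdf) (weight-roman {twos = twos} λ { (_ , ()) }))
      where
      twos : List (Fin N)
      twos = u ∷ v ∷ []
      f : Fin N → RVal
      f = roman twos []
      side-u≢v : side u ≢ side v
      side-u≢v su≡sv = contradiction (trans (sym (sameSide⇒adj u≢v su≡sv)) Guv) λ ()
      dominated : ∀ x → x ∉ twos → x ∉ [] → ∃ λ y → y ∈ twos × addEdge G u v x y ≡ true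
      dominated x x∉twos _ with side x ≟ᵇ side u
      ... | yes sx≡su = u , here refl , addEdge-⊇ G u v (sameSide⇒adj (x∉twos ∘ here) sx≡su)
      ... | no sx≢su  = v , there (here refl) , addEdge-⊇ G u v (sameSide⇒adj (x∉twos ∘ there ∘ here) sx≡sv)
        where
        sx≡sv : side x ≡ side v
        sx≡sv = trans (¬-not sx≢su) (sym (¬-not (side-u≢v ∘ sym)))
      paired : ∀ {x} → x ∈ twos ++ [] → ∃ λ y → y ∈ twos ++ [] × addEdge G u v x y ≡ true
      paired (here refl)         = v , there (here refl) , addEdge-uv G u v
      paired (there (here refl)) = u , here refl , addEdge-vu G u v
      trdf : IsTRDF (addEdge G u v) f
      trdf = roman-isTRDF dominated paired

  LargeCliquePair⇒supercritical : EdgeSupercritical 6 G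
  LargeCliquePair⇒supercritical =
    neighbour , γtR≡6 , (a₀ , b₀ , a₀≢b₀ , Ga₀b₀≡false) , γtR-drop
    where
    a₀≢b₀ : a₀ ≢ b₀
    a₀≢b₀ = ≢-acrossSides a₀∈ b₀∈
    Ga₀b₀≡false : G a₀ b₀ ≡ false
    Ga₀b₀≡false with G a₀ b₀ in Ga₀b₀
    ... | true  = contradiction (trans (sym a₀∈) (trans (adj⇒sameSide Ga₀b₀) b₀∈)) λ ()
    ... | false = refl

module _ {N} {G : Adj N} {side : Fin N → Bool} (simple : IsSimple G) (cp : IsCliquePair G side)
         (6≤weight : ∀ f → IsTRDF G f → 6 ≤ weight f) where
  open IsCliquePair cp

  private
    loopless : Loopless G
    loopless = proj₂ simple

    -- Otherwise d ↦ 2 and c, c′, d′ ↦ 1 is a TRD-function of weight 5.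
    thirdOnSide : ∀ {c c′ d d′} → G c c′ ≡ true → G d d′ ≡ true → side c ≢ side d →
      ∃ λ x → side x ≡ side c × x ≢ c × x ≢ c′
    thirdOnSide {c} {c′} {d} {d′} Gcc′ Gdd′ sc≢sd
      with any? (λ x → (side x ≟ᵇ side c) ×-dec ¬? (x ≟ᶠ c) ×-dec ¬? (x ≟ᶠ c′))
    ... | yes third = third
    ... | no ∄third = contradiction (≤-trans (6≤weight f trdf) (weight-roman twos∩ones=∅)) 1+n≰n
      where
      twos ones : List (Fin N)
      twos = d ∷ []
      ones = c ∷ c′ ∷ d′ ∷ []
      f : Fin N → RVal
      f = roman twos ones
      sc′≡sc : side c′ ≡ side c
      sc′≡sc = sym (adj⇒sameSide Gcc′)
      dominated : ∀ v → v ∉ twos → v ∉ ones → ∃ λ u → u ∈ twos × G v u ≡ true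
      dominated v v∉twos v∉ones = d , here refl , sameSide⇒adj (v∉twos ∘ here) sv≡sd
        where
        sv≢sc : side v ≢ side c
        sv≢sc sv≡sc = ∄third (v , sv≡sc , v∉ones ∘ here , v∉ones ∘ there ∘ here)
        sv≡sd : side v ≡ side d
        sv≡sd = trans (¬-not sv≢sc) (sym (¬-not (sc≢sd ∘ sym)))
      paired : ∀ {v} → v ∈ twos ++ ones → ∃ λ u → u ∈ twos ++ ones × G v u ≡ true
      paired (here refl)                         = d′ , there (there (there (here refl))) , Gdd′
      paired (there (here refl))                 = c′ , there (there (here refl)) , Gcc′
      paired (there (there (here refl)))         = c , there (here refl) , trans (proj₁ simple c′ c) Gcc′
      paired (there (there (there (here refl)))) = d , here refl , trans (proj₁ simple d′ d) Gdd′
      twos∩ones=∅ : Disjoint twos ones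
      twos∩ones=∅ (here refl , here d≡c)                 = sc≢sd (cong side (sym d≡c))
      twos∩ones=∅ (here refl , there (here d≡c′))        = sc≢sd (trans (sym sc′≡sc) (cong side (sym d≡c′)))
      twos∩ones=∅ (here refl , there (there (here d≡d′))) = adj⇒≢ {A = G} loopless Gdd′ d≡d′
      trdf : IsTRDF G f
      trdf = roman-isTRDF dominated paired

  largeSides : NoIsolated G → (∀ s → ∃ λ x → side x ≡ s) → ∀ s → Triple (λ x → side x ≡ s)
  largeSides noIsolated inhabited s =
    let c , sc≡s = inhabited s
        d , sd≡¬s = inhabited (not s)
        c′ , Gcc′ = noIsolated c
        d′ , Gdd′ = noIsolated d
        x , sx≡sc , x≢c , x≢c′ = thirdOnSide Gcc′ Gdd′ λ sc≡sd → not-¬ sc≡s (trans sc≡sd sd≡¬s)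
    in triple c c′ x sc≡s (trans (sym (adj⇒sameSide Gcc′)) sc≡s) (trans sx≡sc sc≡s)
              (adj⇒≢ {A = G} loopless Gcc′) (x≢c ∘ sym) (x≢c′ ∘ sym)

module _ {N} {G : Adj N} (simple : IsSimple G) (disconnected : Disconnected G)
         (sc : EdgeSupercritical 6 G) where

  private
    symmetric : ∀ x y → G x y ≡ G y x
    symmetric = proj₁ simple

    noIsolated : NoIsolated G
    noIsolated = proj₁ sc

    no-third-component : ∀ {u w z} → NonEdge G u w → ¬ Reach G u z → ¬ Reach G w z → ⊥
    no-third-component uw ¬u⇝z ¬w⇝z = supercritical⇒lightTRDF sc uw λ (h , trdf , light) →
      1+n≰n (≤-trans (+-monoˡ-≤ 2 (bridged-weight≥5 simple noIsolated uw ¬u⇝z ¬w⇝z trdf)) light)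

    reach⇒adj : ∀ {u w} → Reach G u w → u ≢ w → G u w ≡ true
    reach⇒adj {u} {w} u⇝w u≢w with G u w in Guw
    ... | true  = refl
    ... | false = ⊥-elim (¬¬-unreachable symmetric disconnected u λ (z , ¬u⇝z) →
                    no-third-component (u≢w , Guw) ¬u⇝z (¬u⇝z ∘ Reach-trans u⇝w))

    module Component {a b : Fin N} (ab : NonEdge G a b) where

      -- The closed neighbourhood of a, which by reach⇒adj is the component of a.
      side : Fin N → Bool
      side x = (x ==ᶠ a) ∨ G a x

      side⇒reach : ∀ {x} → side x ≡ true → Reach G a x
      side⇒reach {x} sx with x ≟ᶠ a
      ... | yes refl = here
      ... | no _     = step sx here

      reach⇒side : ∀ {x} → Reach G a x → side x ≡ true
      reach⇒side {x} a⇝x with x ≟ᶠ a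
      ... | yes _   = refl
      ... | no x≢a = reach⇒adj a⇝x (x≢a ∘ sym)

      ¬reach : ∀ {x} → side x ≡ false → ¬ Reach G x a
      ¬reach sx x⇝a = contradiction (trans (sym (reach⇒side (Reach-sym symmetric x⇝a))) sx) λ ()

      isCliquePair : IsCliquePair G side
      isCliquePair = record { adj⇒sameSide = adj⇒sameSide ; sameSide⇒adj = sameSide⇒adj }
        where
        adj⇒sameSide : ∀ {u v} → G u v ≡ true → side u ≡ side v
        adj⇒sameSide {u} {v} Guv = ⇔→≡ {z = true} (mk⇔
          (λ su → reach⇒side (Reach-snoc (side⇒reach su) Guv))
          (λ sv → reach⇒side (Reach-snoc (side⇒reach sv) (trans (symmetric v u) Guv))))
        sameSide⇒adj : ∀ {u v} → u ≢ v → side u ≡ side v → G u v ≡ true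
        sameSide⇒adj {u} {v} u≢v su≡sv with side u in su
        ... | true  =
          reach⇒adj (Reach-trans (Reach-sym symmetric (side⇒reach su)) (side⇒reach (sym su≡sv))) u≢v
        ... | false with G u v in Guv
        ...   | true  = refl
        ...   | false = ⊥-elim (no-third-component (u≢v , Guv) (¬reach su) (¬reach (sym su≡sv)))

      inhabited : ∀ s → ∃ λ x → side x ≡ s
      inhabited true  = a , reach⇒side here
      inhabited false with side b in sb
      ... | false = b , sb
      ... | true  = contradiction (trans (sym (reach⇒adj (side⇒reach sb) (proj₁ ab))) (proj₂ ab)) λ ()

  supercritical⇒LargeCliquePair : LargeCliquePair G
  supercritical⇒LargeCliquePair with a , b , ab ← proj₁ (proj₂ (proj₂ sc)) = record
    { side = side
    ; isCliquePair = isCliquePair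
    ; large = largeSides simple isCliquePair (proj₂ (proj₁ (proj₂ sc))) noIsolated inhabited
    }
    where open Component ab

-- Isomorphism with K_n ∪ K_m

↔-injective : ∀ {A B : Set} (φ : A ↔ B) → Injective _≡_ _≡_ (Inverse.to φ)
↔-injective φ = Injection.injective (↔⇒↣ φ)

isLeft : ∀ {A B : Set} → A ⊎ B → Bool
isLeft = [ const true , const false ]

↑ˡ-<ᵇ : ∀ {n} m (i : Fin n) → (toℕ (i ↑ˡ m) <ᵇ n) ≡ true
↑ˡ-<ᵇ m zero    = refl
↑ˡ-<ᵇ m (suc i) = ↑ˡ-<ᵇ m i

↑ʳ-<ᵇ : ∀ {m} n (j : Fin m) → (toℕ (n ↑ʳ j) <ᵇ n) ≡ false
↑ʳ-<ᵇ zero    j = refl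
↑ʳ-<ᵇ (suc n) j = ↑ʳ-<ᵇ n j

join-<ᵇ : ∀ n m (s : Fin n ⊎ Fin m) → (toℕ (join n m s) <ᵇ n) ≡ isLeft s
join-<ᵇ n m (inj₁ i) = ↑ˡ-<ᵇ m i
join-<ᵇ n m (inj₂ j) = ↑ʳ-<ᵇ n j

record Bipartition {N} (side : Fin N → Bool) : Set where
  field
    left right   : ℕ
    split        : Fin N ↔ (Fin left ⊎ Fin right)
    isLeft-split : ∀ x → isLeft (Inverse.to split x) ≡ side x

module _ where
  open Bipartition

  flipBipartition : ∀ {N} {side side′ : Fin N → Bool} → Bipartition side → (∀ x → side′ x ≡ not (side x)) →
    Bipartition side′
  flipBipartition B side′≡ = record
    { left = right B
    ; right = left B
    ; split = ⊎-comm _ _ ↔-∘ split B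
    ; isLeft-split = λ x → trans (isLeft-swap (Inverse.to (split B) x))
                                 (trans (cong not (isLeft-split B x)) (sym (side′≡ x)))
    }
    where
    isLeft-swap : ∀ s → isLeft (swap s) ≡ not (isLeft s)
    isLeft-swap (inj₁ _) = refl
    isLeft-swap (inj₂ _) = refl

  consLeft : ∀ {N} {side : Fin (suc N) → Bool} → Bipartition (side ∘ suc) → side zero ≡ true → Bipartition side
  consLeft {N} B side₀ = record
    { left = suc (left B)
    ; right = right B
    ; split = mk↔ₛ′ to′ from′ to′∘from′ from′∘to′
    ; isLeft-split = λ { zero → sym side₀ ; (suc x) → trans (isLeft-map₁ (to x)) (isLeft-split B x) }
    }
    where
    open Inverse (split B)
    to′ : Fin (suc N) → Fin (suc (left B)) ⊎ Fin (right B)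
    to′ zero    = inj₁ zero
    to′ (suc x) = map₁ suc (to x)
    from′ : Fin (suc (left B)) ⊎ Fin (right B) → Fin (suc N)
    from′ (inj₁ zero)    = zero
    from′ (inj₁ (suc i)) = suc (from (inj₁ i))
    from′ (inj₂ j)       = suc (from (inj₂ j))
    to′∘from′ : ∀ s → to′ (from′ s) ≡ s
    to′∘from′ (inj₁ zero)    = refl
    to′∘from′ (inj₁ (suc i)) = cong (map₁ suc) (strictlyInverseˡ (inj₁ i))
    to′∘from′ (inj₂ j)       = cong (map₁ suc) (strictlyInverseˡ (inj₂ j))
    from′-map₁ : ∀ s → from′ (map₁ suc s) ≡ suc (from s)
    from′-map₁ (inj₁ _) = refl
    from′-map₁ (inj₂ _) = refl
    from′∘to′ : ∀ x → from′ (to′ x) ≡ x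
    from′∘to′ zero    = refl
    from′∘to′ (suc x) = trans (from′-map₁ (to x)) (cong suc (strictlyInverseʳ x))
    isLeft-map₁ : ∀ s → isLeft (map₁ suc s) ≡ isLeft s
    isLeft-map₁ (inj₁ _) = refl
    isLeft-map₁ (inj₂ _) = refl

  bipartition : ∀ {N} (side : Fin N → Bool) → Bipartition side
  bipartition {zero} side = record
    { left = 0
    ; right = 0
    ; split = mk↔ₛ′ (λ ()) (λ { (inj₁ ()) ; (inj₂ ()) }) (λ { (inj₁ ()) ; (inj₂ ()) }) (λ ())
    ; isLeft-split = λ ()
    }
  bipartition {suc N} side with side zero in side₀
  ... | true  = consLeft (bipartition (side ∘ suc)) side₀
  ... | false = flipBipartition (consLeft {side = not ∘ side} B′ (cong not side₀)) λ x → sym (not-involutive (side x))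
    where
    B′ : Bipartition (not ∘ side ∘ suc)
    B′ = flipBipartition (bipartition (side ∘ suc)) λ _ → refl

  3≤left : ∀ {N} {side : Fin N → Bool} (B : Bipartition side) → Triple (λ x → side x ≡ true) → 3 ≤ left B
  3≤left {side = side} B (triple a b c a∈ b∈ c∈ a≢b a≢c b≢c) =
    Triple⇒3≤ {S = λ _ → ⊤} (triple (index a∈) (index b∈) (index c∈) tt tt tt
      (a≢b ∘ index-injective a∈ b∈) (a≢c ∘ index-injective a∈ c∈) (b≢c ∘ index-injective b∈ c∈))
    where
    open Inverse (split B)
    leftIndex : ∀ {x} → side x ≡ true → ∃ λ i → to x ≡ inj₁ i
    leftIndex {x} sx with to x | isLeft-split B x
    ... | inj₁ i | _    = i , refl
    ... | inj₂ _ | f≡sx = contradiction (trans f≡sx sx) λ ()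
    index : ∀ {x} → side x ≡ true → Fin (left B)
    index = proj₁ ∘ leftIndex
    index-injective : ∀ {x y} (sx : side x ≡ true) (sy : side y ≡ true) → index sx ≡ index sy → x ≡ y
    index-injective sx sy i≡j =
      ↔-injective (split B) (trans (proj₂ (leftIndex sx)) (trans (cong inj₁ i≡j) (sym (proj₂ (leftIndex sy)))))

  3≤right : ∀ {N} {side : Fin N → Bool} (B : Bipartition side) → Triple (λ x → side x ≡ false) → 3 ≤ right B
  3≤right B T = 3≤left (flipBipartition B λ _ → refl) (Triple-map (cong not) T)

module _ {N} {G : Adj N} where

  ≅KnUKm⇒LargeCliquePair : ∀ {n m} → G ≅ KnUKm n m → 3 ≤ n → 3 ≤ m → LargeCliquePair G
  ≅KnUKm⇒LargeCliquePair {n} {m} (φ , G≅) 3≤n 3≤m = record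
    { side = side
    ; isCliquePair = ≗cliquePairAdj⇒IsCliquePair G≗
    ; large = λ { true  → sideTriple 3≤n (_↑ˡ m) (↑ˡ-injective m _ _) (↑ˡ-<ᵇ m)
                ; false → sideTriple 3≤m (n ↑ʳ_) (↑ʳ-injective n _ _) (↑ʳ-<ᵇ n) }
    }
    where
    open Inverse φ
    side : Fin N → Bool
    side x = toℕ (to x) <ᵇ n
    G≗ : ∀ u v → G u v ≡ cliquePairAdj side u v
    G≗ u v = trans (G≅ u v)
      (sym (cliquePairAdj-relabel {side′ = λ i → toℕ i <ᵇ n} to (↔-injective φ) (λ _ → refl) u v))
    sideTriple : ∀ {k s} → 3 ≤ k → (ι : Fin k → Fin (n + m)) → Injective _≡_ _≡_ ι →
      (∀ i → (toℕ (ι i) <ᵇ n) ≡ s) → Triple (λ x → side x ≡ s)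
    sideTriple 3≤k ι ι-injective ι-side = Triple-Fin 3≤k (from ∘ ι) (ι-injective ∘ ↔-injective (↔-sym φ))
      λ i → trans (cong (λ y → toℕ y <ᵇ n) (strictlyInverseˡ (ι i))) (ι-side i)

  LargeCliquePair⇒≅KnUKm : Loopless G → LargeCliquePair G → ∃ λ n → ∃ λ m → 3 ≤ n × 3 ≤ m × G ≅ KnUKm n m
  LargeCliquePair⇒≅KnUKm loopless L =
    left , right , 3≤left B (large true) , 3≤right B (large false) , φ , G≅
    where
    open LargeCliquePair L
    B : Bipartition side
    B = bipartition side
    open Bipartition B
    φ : Fin N ↔ Fin (left + right)
    φ = ↔-sym +↔⊎ ↔-∘ split
    side≡ : ∀ x → side x ≡ (toℕ (Inverse.to φ x) <ᵇ left)
    side≡ x = sym (trans (join-<ᵇ left right (Inverse.to split x)) (isLeft-split x))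
    G≅ : ∀ u v → G u v ≡ KnUKm left right (Inverse.to φ u) (Inverse.to φ v)
    G≅ u v = trans (IsCliquePair⇒≗cliquePairAdj loopless isCliquePair u v)
                   (cliquePairAdj-relabel {side′ = λ i → toℕ i <ᵇ left} (Inverse.to φ) (↔-injective φ) side≡ u v)

proposition6p1 : ∀ (N : ℕ) (G : Adj N) → IsSimple G → Disconnected G →
    (EdgeSupercritical 6 G ⇔ (∃ λ n → ∃ λ m → 3 ≤ n × 3 ≤ m × G ≅ KnUKm n m))
proposition6p1 N G simple disconnected = mk⇔
  (LargeCliquePair⇒≅KnUKm (proj₂ simple) ∘ supercritical⇒LargeCliquePair simple disconnected)
  (λ (n , m , 3≤n , 3≤m , G≅K) → LargeCliquePair⇒supercritical simple (≅KnUKm⇒LargeCliquePair G≅K 3≤n 3≤m))
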